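{- For every $n\geq 1$, every $(2n-1)$-universal tree is a parity-constrained minor-universal tree for the class of rooted binary trees with $n$ leaves and no node of degree $1$.
   Context: Trees are finite and rooted; the degree of a node is its number of children; the depth of the root is $0$; binary means at most two children per node; $\mathsf{NCA}$ is the nearest common ancestor; $\mathsf{inner}(T')$ is the set of non-leaf nodes of $T'$. Cutting: select nodes $a,b$ with $a$ a child of $b$, and remove the entire subtree rooted at $a$ and the edge between $a$ and $b$. Contraction: select an internal node $b$ with parent $a$ and exactly one child $c$; remove $b$; if $c$ is internal, the children of $c$ are made children of $a$ and $c$ is removed; if $c$ is a leaf, it becomes a child of $a$. $T$ implements $T'$ if $T'$ can be obtained from $T$ by a sequence of cuttings and contractions. $T$ is $m$-universal if it implements every rooted tree with at most $m$ leaves and no node of degree $1$. A rooted tree $T$ is a parity-constrained minor-universal tree for a class $\mathcal{T}$ if for every $T'\in\mathcal{T}$ and every assignment $c:\mathsf{inner}(T')\to\{0,1\}$ there is an injective map $f$ from the nodes of $T'$ to the nodes of $T$ with $f(\mathsf{NCA}(u,v))=\mathsf{NCA}(f(u),f(v))$ for all $u,v\in T'$ and such that for every $v\in\mathsf{inner}(T')$, $f(v)$ is at even depth if $c(v)=0$ and at odd depth if $c(v)=1$. -}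

module Defs where

open import Data.Nat using (ℕ; zero; suc; _≤_; _≡ᵇ_)
open import Data.Bool using (Bool; true; false; not; if_then_else_)
open import Data.List using (List; []; _∷_; _++_; [_]; length)
open import Data.Maybe using (Maybe; just; nothing)
open import Data.Product using (Σ; _×_; ∃; ∃-syntax; _,_)
open import Relation.Binary.PropositionalEquality using (_≡_; _≢_)
open import Relation.Binary.Construct.Closure.ReflexiveTransitive using (Star)
open import Data.List.Relation.Binary.Permutation.Propositional using (_↭_)

-- Finite rooted trees (rose trees).  Children are stored in a list; the
-- order is irrelevant since `Implements` allows permuting children freely.
data Tree : Set where
  node : List Tree → Tree

leaf : Tree
leaf = node []

-- Positions (nodes) are paths of child indices from the root.
Path : Set
Path = List ℕ

mutual
  sub : Tree → Path → Maybe Tree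
  sub t [] = just t
  sub (node cs) (i ∷ p) = subL cs i p

  subL : List Tree → ℕ → Path → Maybe Tree
  subL [] _ _ = nothing
  subL (c ∷ cs) zero p = sub c p
  subL (c ∷ cs) (suc i) p = subL cs i p

IsNode : Tree → Path → Set
IsNode t p = Σ Tree λ s → sub t p ≡ just s

Inner : Tree → Path → Set
Inner t p = Σ Tree λ c → Σ (List Tree) λ cs → sub t p ≡ just (node (c ∷ cs))

-- depth of the node at path p is length p; NCA of nodes p, q is the
-- longest common prefix of their paths.
nca : Path → Path → Path
nca [] _ = []
nca (_ ∷ _) [] = []
nca (x ∷ xs) (y ∷ ys) = if x ≡ᵇ y then x ∷ nca xs ys else []

-- parity: false = even, true = odd
parity : ℕ → Bool
parity zero = false
parity (suc n) = not (parity n)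

mutual
  leaves : Tree → ℕ
  leaves (node []) = 1
  leaves (node (c ∷ cs)) = leavesL (c ∷ cs)

  leavesL : List Tree → ℕ
  leavesL [] = 0
  leavesL (c ∷ cs) = leaves c Data.Nat.+ leavesL cs

mutual
  NoUnary : Tree → Set
  NoUnary (node cs) = (length cs ≢ 1) × NoUnaryL cs

  NoUnaryL : List Tree → Set
  NoUnaryL [] = Data.Unit.⊤ where import Data.Unit
  NoUnaryL (c ∷ cs) = NoUnary c × NoUnaryL cs

mutual
  Binary : Tree → Set
  Binary (node cs) = (length cs ≤ 2) × BinaryL cs

  BinaryL : List Tree → Set
  BinaryL [] = Data.Unit.⊤ where import Data.Unit
  BinaryL (c ∷ cs) = Binary c × BinaryL cs

mutual
  modify : (List Tree → List Tree) → Path → Tree → Tree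
  modify g [] (node cs) = node (g cs)
  modify g (i ∷ p) (node cs) = node (modifyL g i p cs)

  modifyL : (List Tree → List Tree) → ℕ → Path → List Tree → List Tree
  modifyL g _ p [] = []
  modifyL g zero p (c ∷ cs) = modify g p c ∷ cs
  modifyL g (suc i) p (c ∷ cs) = c ∷ modifyL g i p cs

replaceAt : ℕ → List Tree → List Tree → List Tree
replaceAt _ ys [] = []
replaceAt zero ys (x ∷ xs) = ys ++ xs
replaceAt (suc i) ys (x ∷ xs) = x ∷ replaceAt i ys xs

-- what replaces a contracted node b whose single child is c
contractRes : Tree → List Tree
contractRes (node []) = [ node [] ]         -- c is a leaf: c becomes child of a
contractRes (node (d ∷ ds)) = d ∷ ds        -- c internal: children of c become children of a

data Step : Tree → Tree → Set where
  cut : ∀ {t} (p : Path) (i : ℕ) → IsNode t (p ++ [ i ]) →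
        Step t (modify (replaceAt i []) p t)
  -- contraction: b at path p ++ [i] (parent a at p) has exactly one child c
  contract : ∀ {t} (p : Path) (i : ℕ) (c : Tree) →
        sub t (p ++ [ i ]) ≡ just (node (c ∷ [])) →
        Step t (modify (replaceAt i (contractRes c)) p t)
  -- reordering children (trees are unordered)
  perm : ∀ {t} (p : Path) (cs ds : List Tree) →
        sub t p ≡ just (node cs) → cs ↭ ds →
        Step t (modify (λ _ → ds) p t)

Implements : Tree → Tree → Set
Implements = Star Step

Universal : ℕ → Tree → Set
Universal m T = ∀ T' → leaves T' ≤ m → NoUnary T' → Implements T T'

ParityUniversal : (Tree → Set) → Tree → Set
ParityUniversal 𝒯 T =
  ∀ T' → 𝒯 T' → (c : (p : Path) → Inner T' p → Bool) →
  Σ (Path → Path) λ f → ( (∀ p → IsNode T' p → IsNode T (f p))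
         × (∀ p q → IsNode T' p → IsNode T' q → f p ≡ f q → p ≡ q)
         × (∀ p q → IsNode T' p → IsNode T' q → f (nca p q) ≡ nca (f p) (f q))
         × (∀ p (ip : Inner T' p) → parity (length (f p)) ≡ c p ip) )

BinaryClass : ℕ → Tree → Set
BinaryClass n T = Binary T × NoUnary T × leaves T ≡ n

module Submission where

-- A binary tree T' together with a parity colouring c of
-- its inner nodes is recorded as a labelled binary *pattern* X.  We define when
-- X embeds into a tree Y whose root sits at a given parity: inner pattern
-- nodes go to nodes of the right parity, and the two subpatterns go into two
-- distinct child subtrees.  Such an embedding yields exactly the injective,
-- NCA-preserving, parity-respecting map the theorem asks for (extraction).
--
-- The proof has three parts.
--   1. Dominance.  Write t ⊒ s when every pattern embedding into s also
--      embeds into t.  Each cutting, contraction and reordering step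
--      t ⟶ t' satisfies t ⊒ t', hence so does every implementation.
--   2. Realisation.  Every pattern X with m leaves is realised, at either
--      root parity, by a tree without unary nodes having at most 2m - 1
--      leaves: a node whose parity is off is pushed down by one level next
--      to a fresh leaf.
--   3. Extraction of the map from an embedding.
-- A (2n-1)-universal tree implements the realisation of the pattern of
-- (T', c), so by dominance the pattern embeds into it, and extraction ends
-- the proof.

open import Defs
open import Data.Nat using (ℕ; zero; suc; _≤_; _*_; _∸_; _+_; z≤n; s≤s; _≡ᵇ_)
open import Data.Nat.Properties
  using (suc-injective; +-identityʳ; +-suc; *-distribˡ-+; +-mono-≤; ∸-monoˡ-≤; n≤1+n; ≤-refl; module ≤-Reasoning)
open import Data.Bool using (Bool; true; false; not)
open import Data.Bool.Properties using (not-involutive)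
open import Data.List using (List; []; _∷_; _++_; [_]; length)
open import Data.List.Properties using (++-cancelˡ; ∷-injectiveˡ; ∷-injectiveʳ)
open import Data.List.Relation.Unary.Any using (Any; here; there)
open import Data.List.Relation.Unary.Any.Properties using (++⁻)
open import Data.List.Relation.Binary.Permutation.Propositional using (_↭_; refl; prep; swap; trans; ↭-sym)
open import Data.List.Relation.Binary.Permutation.Propositional.Properties using (Any-resp-↭; shift)
open import Data.Maybe using (just)
open import Data.Product using (Σ; _×_; _,_)
open import Data.Sum using (inj₁; inj₂)
open import Data.Empty using (⊥-elim)
open import Data.Unit using (tt)
open import Relation.Binary.PropositionalEquality
  using (_≡_; _≢_; refl; sym; cong; subst; module ≡-Reasoning) renaming (trans to ≡-trans)
open import Relation.Binary.Construct.Closure.ReflexiveTransitive using (ε; _◅_)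

-- Patterns and their embeddings

-- A binary pattern; every inner node carries the parity its image must have.
data Pattern : Set where
  pleaf : Pattern
  pnode : Bool → Pattern → Pattern → Pattern

size : Pattern → ℕ
size pleaf = 1
size (pnode _ l r) = size l + size r

-- Two P Q cs: two distinct members of cs, one satisfying P, the other Q.
data Two (P Q : Tree → Set) : List Tree → Set where
  firstP : ∀ {c cs} → P c → Any Q cs → Two P Q (c ∷ cs)
  firstQ : ∀ {c cs} → Q c → Any P cs → Two P Q (c ∷ cs)
  later  : ∀ {c cs} → Two P Q cs → Two P Q (c ∷ cs)

mutual
  -- RootEmb X π Y: X embeds into Y, with the root of X sent to the root of
  -- Y, the root of Y having parity π.
  data RootEmb : Pattern → Bool → Tree → Set where
    leafEmb : ∀ {π Y} → RootEmb pleaf π Y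
    nodeEmb : ∀ {b l r cs} → Two (Emb l (not b)) (Emb r (not b)) cs →
              RootEmb (pnode b l r) b (node cs)

  data Emb (X : Pattern) : Bool → Tree → Set where
    atRoot : ∀ {π Y} → RootEmb X π Y → Emb X π Y
    below  : ∀ {π cs} → Any (Emb X (not π)) cs → Emb X π (node cs)

-- Dominance, and its preservation by implementation steps

_⊒_ : Tree → Tree → Set
t ⊒ s = ∀ X π → Emb X π s → Emb X π t

⊒-refl : ∀ {t} → t ⊒ t
⊒-refl X π e = e

⊒-trans : ∀ {t s u} → t ⊒ s → s ⊒ u → t ⊒ u
⊒-trans ts su X π e = ts X π (su X π e)

-- A leaf is dominated by every tree: only the one-leaf pattern embeds into it.
leaf-least : ∀ t → t ⊒ leaf
leaf-least t X π (atRoot leafEmb) = atRoot leafEmb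

node-⊒ : ∀ {cs ds} →
  (∀ X π → Any (Emb X π) ds → Any (Emb X π) cs) →
  (∀ l r π → Two (Emb l π) (Emb r π) ds → Two (Emb l π) (Emb r π) cs) →
  node cs ⊒ node ds
node-⊒ one two X π (atRoot leafEmb) = atRoot leafEmb
node-⊒ one two (pnode b l r) .b (atRoot (nodeEmb t)) = atRoot (nodeEmb (two l r (not b) t))
node-⊒ one two X π (below a) = below (one X (not π) a)

Two-resp-↭ : ∀ {P Q xs ys} → xs ↭ ys → Two P Q xs → Two P Q ys
Two-resp-↭ refl t = t
Two-resp-↭ (prep x σ) (firstP p q) = firstP p (Any-resp-↭ σ q)
Two-resp-↭ (prep x σ) (firstQ q p) = firstQ q (Any-resp-↭ σ p)
Two-resp-↭ (prep x σ) (later t) = later (Two-resp-↭ σ t)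
Two-resp-↭ (swap x y σ) (firstP p (here q)) = firstQ q (here p)
Two-resp-↭ (swap x y σ) (firstP p (there q)) = later (firstP p (Any-resp-↭ σ q))
Two-resp-↭ (swap x y σ) (firstQ q (here p)) = firstP p (here q)
Two-resp-↭ (swap x y σ) (firstQ q (there p)) = later (firstQ q (Any-resp-↭ σ p))
Two-resp-↭ (swap x y σ) (later (firstP p q)) = firstP p (there (Any-resp-↭ σ q))
Two-resp-↭ (swap x y σ) (later (firstQ q p)) = firstQ q (there (Any-resp-↭ σ p))
Two-resp-↭ (swap x y σ) (later (later t)) = later (later (Two-resp-↭ σ t))
Two-resp-↭ (trans σ τ) t = Two-resp-↭ τ (Two-resp-↭ σ t)

↭-⊒ : ∀ {cs ds} → cs ↭ ds → node cs ⊒ node ds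
↭-⊒ σ = node-⊒ (λ _ _ → Any-resp-↭ (↭-sym σ)) (λ _ _ _ → Two-resp-↭ (↭-sym σ))

-- ds ≼ cs: ds arises from a sublist of cs by replacing each kept child by a
-- tree it dominates.  This covers deletions and changes deep inside children.
data _≼_ : List Tree → List Tree → Set where
  done : [] ≼ []
  skip : ∀ {c ds cs} → ds ≼ cs → ds ≼ (c ∷ cs)
  keep : ∀ {c d ds cs} → c ⊒ d → ds ≼ cs → (d ∷ ds) ≼ (c ∷ cs)

≼-refl : ∀ {cs} → cs ≼ cs
≼-refl {[]} = done
≼-refl {c ∷ cs} = keep ⊒-refl ≼-refl

Any-≼ : ∀ {X π ds cs} → ds ≼ cs → Any (Emb X π) ds → Any (Emb X π) cs
Any-≼ (skip h) a = there (Any-≼ h a)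
Any-≼ (keep d h) (here e) = here (d _ _ e)
Any-≼ (keep d h) (there a) = there (Any-≼ h a)

Two-≼ : ∀ {l r π ds cs} → ds ≼ cs → Two (Emb l π) (Emb r π) ds → Two (Emb l π) (Emb r π) cs
Two-≼ (skip h) t = later (Two-≼ h t)
Two-≼ (keep d h) (firstP p q) = firstP (d _ _ p) (Any-≼ h q)
Two-≼ (keep d h) (firstQ q p) = firstQ (d _ _ q) (Any-≼ h p)
Two-≼ (keep d h) (later t) = later (Two-≼ h t)

≼-⊒ : ∀ {cs ds} → ds ≼ cs → node cs ⊒ node ds
≼-⊒ h = node-⊒ (λ _ _ → Any-≼ h) (λ _ _ _ → Two-≼ h)

remove-≼ : ∀ i cs → replaceAt i [] cs ≼ cs
remove-≼ i [] = done
remove-≼ zero (c ∷ cs) = skip ≼-refl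
remove-≼ (suc i) (c ∷ cs) = keep ⊒-refl (remove-≼ i cs)

data TwoSplit (P Q : Tree → Set) (D R : List Tree) : Set where
  inRight : Two P Q R → TwoSplit P Q D R
  inLeft  : Two P Q D → TwoSplit P Q D R
  crossPQ : Any P D → Any Q R → TwoSplit P Q D R
  crossQP : Any Q D → Any P R → TwoSplit P Q D R

Two-++⁻ : ∀ {P Q} D {R} → Two P Q (D ++ R) → TwoSplit P Q D R
Two-++⁻ [] t = inRight t
Two-++⁻ (d ∷ D) (firstP p q) with ++⁻ D q
... | inj₁ qD = inLeft (firstP p qD)
... | inj₂ qR = crossPQ (here p) qR
Two-++⁻ (d ∷ D) (firstQ q p) with ++⁻ D p
... | inj₁ pD = inLeft (firstQ q pD)
... | inj₂ pR = crossQP (here q) pR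
Two-++⁻ (d ∷ D) (later t) with Two-++⁻ D t
... | inRight x = inRight x
... | inLeft x = inLeft (later x)
... | crossPQ x y = crossPQ (there x) y
... | crossQP x y = crossQP (there x) y

-- A chain of two edges does not change parity, so an embedding into node D
-- persists into node [ node D ] one parity level higher.
lift₂ : ∀ {X π D} → Emb X π (node D) → Emb X (not π) (node [ node D ])
lift₂ {X} {π} {D} e = below (here (subst (λ ρ → Emb X ρ (node D)) (sym (not-involutive π)) e))

splice-⊒ : ∀ D R → node (node [ node D ] ∷ R) ⊒ node (D ++ R)
splice-⊒ D R X π (atRoot leafEmb) = atRoot leafEmb
splice-⊒ D R (pnode b l r) .b (atRoot (nodeEmb t)) with Two-++⁻ D t
... | inRight x = atRoot (nodeEmb (later x))
... | inLeft x = below (here (lift₂ (atRoot (nodeEmb x))))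
... | crossPQ x y = atRoot (nodeEmb (firstP (lift₂ (below x)) y))
... | crossQP x y = atRoot (nodeEmb (firstQ (lift₂ (below x)) y))
splice-⊒ D R X π (below a) with ++⁻ D a
... | inj₁ x = below (here (lift₂ (below x)))
... | inj₂ y = below (there y)

contract-head-⊒ : ∀ c R → node (node [ c ] ∷ R) ⊒ node (contractRes c ++ R)
contract-head-⊒ (node []) R = ≼-⊒ (keep (leaf-least _) ≼-refl)
contract-head-⊒ (node (d ∷ ds)) R = splice-⊒ (d ∷ ds) R

pick-↭ : ∀ i cs {b} → subL cs i [] ≡ just b → cs ↭ b ∷ replaceAt i [] cs
pick-↭ zero (c ∷ cs) refl = refl
pick-↭ (suc i) (c ∷ cs) {b} e = trans (prep c (pick-↭ i cs e)) (swap c b refl)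

replace-↭ : ∀ i E cs {b} → subL cs i [] ≡ just b → replaceAt i E cs ↭ E ++ replaceAt i [] cs
replace-↭ zero E (c ∷ cs) _ = refl
replace-↭ (suc i) E (c ∷ cs) e = trans (prep c (replace-↭ i E cs e)) (↭-sym (shift c E _))

contract-⊒ : ∀ i cs c → subL cs i [] ≡ just (node [ c ]) →
  node cs ⊒ node (replaceAt i (contractRes c) cs)
contract-⊒ i cs c e =
  ⊒-trans (↭-⊒ (pick-↭ i cs e))
    (⊒-trans (contract-head-⊒ c _) (↭-⊒ (↭-sym (replace-↭ i (contractRes c) cs e))))

mutual
  modify-⊒ : ∀ g p t → (∀ cs → sub t p ≡ just (node cs) → node cs ⊒ node (g cs)) →
    t ⊒ modify g p t
  modify-⊒ g [] (node cs) local = local cs refl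
  modify-⊒ g (i ∷ p) (node cs) local = ≼-⊒ (modifyL-≼ g i p cs local)

  modifyL-≼ : ∀ g i p cs → (∀ ds → subL cs i p ≡ just (node ds) → node ds ⊒ node (g ds)) →
    modifyL g i p cs ≼ cs
  modifyL-≼ g i p [] local = done
  modifyL-≼ g zero p (c ∷ cs) local = keep (modify-⊒ g p c local) ≼-refl
  modifyL-≼ g (suc i) p (c ∷ cs) local = keep ⊒-refl (modifyL-≼ g i p cs local)

mutual
  sub-++ : ∀ t p q {s} → sub t p ≡ just s → sub t (p ++ q) ≡ sub s q
  sub-++ t [] q refl = refl
  sub-++ (node cs) (i ∷ p) q e = subL-++ cs i p q e

  subL-++ : ∀ cs i p q {s} → subL cs i p ≡ just s → subL cs i (p ++ q) ≡ sub s q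
  subL-++ (c ∷ cs) zero p q e = sub-++ c p q e
  subL-++ (c ∷ cs) (suc i) p q e = subL-++ cs i p q e

step-⊒ : ∀ {t t'} → Step t t' → t ⊒ t'
step-⊒ {t} (cut p i _) = modify-⊒ _ p t (λ cs _ → ≼-⊒ (remove-≼ i cs))
step-⊒ {t} (contract p i c e) = modify-⊒ _ p t
  (λ cs at-p → contract-⊒ i cs c (≡-trans (sym (sub-++ t p [ i ] at-p)) e))
step-⊒ {t} (perm p cs ds at-p σ) = modify-⊒ _ p t local
  where
  local : ∀ cs' → sub t p ≡ just (node cs') → node cs' ⊒ node ds
  local cs' at-p' with ≡-trans (sym at-p) at-p'
  ... | refl = ↭-⊒ σ

implements-⊒ : ∀ {t t'} → Implements t t' → t ⊒ t'
implements-⊒ ε = ⊒-refl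
implements-⊒ (st ◅ sts) = ⊒-trans (step-⊒ st) (implements-⊒ sts)

-- Realising a pattern by a small tree without unary nodes

-- wrap b π t places t, whose root must have parity b, at parity π: if the
-- parities differ, t is pushed one level down beside a fresh leaf.
wrap : Bool → Bool → Tree → Tree
wrap true true t = t
wrap false false t = t
wrap true false t = node (leaf ∷ t ∷ [])
wrap false true t = node (leaf ∷ t ∷ [])

realise : Pattern → Bool → Tree
realise pleaf π = leaf
realise (pnode b l r) π = wrap b π (node (realise l (not b) ∷ realise r (not b) ∷ []))

wrap-emb : ∀ X b π t → RootEmb X b t → Emb X π (wrap b π t)
wrap-emb X true true t e = atRoot e
wrap-emb X false false t e = atRoot e
wrap-emb X true false t e = below (there (here (atRoot e)))
wrap-emb X false true t e = below (there (here (atRoot e)))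

realise-emb : ∀ X π → Emb X π (realise X π)
realise-emb pleaf π = atRoot leafEmb
realise-emb (pnode b l r) π =
  wrap-emb (pnode b l r) b π _ (nodeEmb (firstP (realise-emb l (not b)) (here (realise-emb r (not b)))))

wrap-noUnary : ∀ b π t → NoUnary t → NoUnary (wrap b π t)
wrap-noUnary true true t N = N
wrap-noUnary false false t N = N
wrap-noUnary true false t N = (λ ()) , ((λ ()) , tt) , N , tt
wrap-noUnary false true t N = (λ ()) , ((λ ()) , tt) , N , tt

realise-noUnary : ∀ X π → NoUnary (realise X π)
realise-noUnary pleaf π = (λ ()) , tt
realise-noUnary (pnode b l r) π =
  wrap-noUnary b π _ ((λ ()) , realise-noUnary l (not b) , realise-noUnary r (not b) , tt)

wrap-leaves : ∀ b π t → leaves (wrap b π t) ≤ suc (leaves t)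
wrap-leaves true true t = n≤1+n _
wrap-leaves false false t = n≤1+n _
wrap-leaves true false t rewrite +-identityʳ (leaves t) = ≤-refl
wrap-leaves false true t rewrite +-identityʳ (leaves t) = ≤-refl

realise-leaves : ∀ X π → suc (leaves (realise X π)) ≤ 2 * size X
realise-leaves pleaf π = s≤s (s≤s z≤n)
realise-leaves (pnode b l r) π = begin
  suc (leaves (wrap b π (node (L ∷ R ∷ [])))) ≤⟨ s≤s (wrap-leaves b π _) ⟩
  suc (suc (leaves L + (leaves R + 0)))        ≡⟨ cong (λ k → suc (suc (leaves L + k))) (+-identityʳ _) ⟩
  suc (suc (leaves L + leaves R))              ≡⟨ cong suc (sym (+-suc (leaves L) (leaves R))) ⟩
  suc (leaves L) + suc (leaves R)              ≤⟨ +-mono-≤ (realise-leaves l (not b)) (realise-leaves r (not b)) ⟩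
  2 * size l + 2 * size r                      ≡⟨ sym (*-distribˡ-+ 2 (size l) (size r)) ⟩
  2 * (size l + size r)                        ∎
  where
  open ≤-Reasoning
  L R : Tree
  L = realise l (not b)
  R = realise r (not b)

-- The pattern of a coloured binary tree

Colouring : Tree → Set
Colouring T = (p : Path) → Inner T p → Bool

leftColouring : ∀ {l r} → Colouring (node (l ∷ r ∷ [])) → Colouring l
leftColouring c p ip = c (0 ∷ p) ip

rightColouring : ∀ {l r} → Colouring (node (l ∷ r ∷ [])) → Colouring r
rightColouring c p ip = c (1 ∷ p) ip

rootColour : ∀ {l r} → Colouring (node (l ∷ r ∷ [])) → Bool
rootColour {l} {r} c = c [] (l , r ∷ [] , refl)

-- Binary inner nodes become pattern nodes labelled by their colour (other
-- shapes do not occur in binary trees without unary nodes).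
annotate : (T : Tree) → Colouring T → Pattern
annotate (node (l ∷ r ∷ [])) c =
  pnode (rootColour c) (annotate l (leftColouring c)) (annotate r (rightColouring c))
annotate _ c = pleaf

annotate-size : ∀ T c → Binary T → NoUnary T → size (annotate T c) ≡ leaves T
annotate-size (node []) c B N = refl
annotate-size (node (x ∷ [])) c B (unary , _) = ⊥-elim (unary refl)
annotate-size (node (l ∷ r ∷ [])) c (_ , Bl , Br , _) (_ , Nl , Nr , _) = begin
  size (annotate l cl) + size (annotate r cr) ≡⟨ cong (_+ size (annotate r cr)) (annotate-size l cl Bl Nl) ⟩
  leaves l + size (annotate r cr)             ≡⟨ cong (leaves l +_) (annotate-size r cr Br Nr) ⟩
  leaves l + leaves r                         ≡⟨ cong (leaves l +_) (sym (+-identityʳ (leaves r))) ⟩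
  leaves l + (leaves r + 0)                   ∎
  where
  open ≡-Reasoning
  cl : Colouring l
  cl = leftColouring c
  cr : Colouring r
  cr = rightColouring c
annotate-size (node (x ∷ y ∷ z ∷ zs)) c (s≤s (s≤s ()) , _) N

-- Extracting the map from an embedding

par : Bool → Path → Bool
par π [] = π
par π (_ ∷ w) = par (not π) w

par-++ : ∀ π w u → par π (w ++ u) ≡ par (par π w) u
par-++ π [] u = refl
par-++ π (x ∷ w) u = par-++ (not π) w u

par-not : ∀ b p → par (not b) p ≡ not (par b p)
par-not b [] = refl
par-not b (x ∷ p) = par-not (not b) p

par-false : ∀ p → par false p ≡ parity (length p)
par-false [] = refl
par-false (x ∷ p) = ≡-trans (par-not false p) (cong not (par-false p))

mutual
  emb-offset : ∀ {X π Y} → Emb X π Y →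
    Σ Path λ w → Σ Tree λ Z → (sub Y w ≡ just Z) × RootEmb X (par π w) Z
  emb-offset {Y = Y} (atRoot e) = [] , Y , refl , e
  emb-offset (below a) with anyEmb-offset a
  ... | i , w , Z , at , e = i ∷ w , Z , at , e

  anyEmb-offset : ∀ {X π cs} → Any (Emb X π) cs →
    Σ ℕ λ i → Σ Path λ w → Σ Tree λ Z → (subL cs i w ≡ just Z) × RootEmb X (par π w) Z
  anyEmb-offset (here e) = zero , emb-offset e
  anyEmb-offset (there a) with anyEmb-offset a
  ... | i , rest = suc i , rest

any-position : ∀ {P : Tree → Set} {cs} → Any P cs → Σ ℕ λ i → Σ Tree λ c → (subL cs i [] ≡ just c) × P c
any-position (here p) = zero , _ , refl , p
any-position (there a) with any-position a
... | i , c , at , p = suc i , c , at , p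

record TwoPositions (P Q : Tree → Set) (cs : List Tree) : Set where
  constructor positions
  field
    i j      : ℕ
    distinct : i ≢ j
    cl cr    : Tree
    at-i     : subL cs i [] ≡ just cl
    at-j     : subL cs j [] ≡ just cr
    Pcl      : P cl
    Qcr      : Q cr

two-positions : ∀ {P Q cs} → Two P Q cs → TwoPositions P Q cs
two-positions (firstP p q) with any-position q
... | k , c , at , qc = positions zero (suc k) (λ ()) _ c refl at p qc
two-positions (firstQ q p) with any-position p
... | k , c , at , pc = positions (suc k) zero (λ ()) c _ at refl pc q
two-positions (later t) with two-positions t
... | positions i j ne cl cr ati atj p q =
  positions (suc i) (suc j) (λ eq → ne (suc-injective eq)) cl cr ati atj p q

ParityEmbedding : (T : Tree) → Colouring T → Tree → Bool → (Path → Path) → Set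
ParityEmbedding T c Y π f = (∀ p → IsNode T p → IsNode Y (f p))
  × (∀ p q → IsNode T p → IsNode T q → f p ≡ f q → p ≡ q)
  × (∀ p q → IsNode T p → IsNode T q → f (nca p q) ≡ nca (f p) (f q))
  × (∀ p (ip : Inner T p) → par π (f p) ≡ c p ip)

≡ᵇ-refl : ∀ i → (i ≡ᵇ i) ≡ true
≡ᵇ-refl zero = refl
≡ᵇ-refl (suc i) = ≡ᵇ-refl i

≢⇒≡ᵇ-false : ∀ i j → i ≢ j → (i ≡ᵇ j) ≡ false
≢⇒≡ᵇ-false zero zero ne = ⊥-elim (ne refl)
≢⇒≡ᵇ-false zero (suc j) ne = refl
≢⇒≡ᵇ-false (suc i) zero ne = refl
≢⇒≡ᵇ-false (suc i) (suc j) ne = ≢⇒≡ᵇ-false i j (λ e → ne (cong suc e))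

nca-same : ∀ i x y → nca (i ∷ x) (i ∷ y) ≡ i ∷ nca x y
nca-same i x y rewrite ≡ᵇ-refl i = refl

nca-diff : ∀ i j x y → i ≢ j → nca (i ∷ x) (j ∷ y) ≡ []
nca-diff i j x y ne rewrite ≢⇒≡ᵇ-false i j ne = refl

nca-prefix : ∀ w x y → nca (w ++ x) (w ++ y) ≡ w ++ nca x y
nca-prefix [] x y = refl
nca-prefix (i ∷ w) x y = ≡-trans (nca-same i (w ++ x) (w ++ y)) (cong (i ∷_) (nca-prefix w x y))

leaf-path : ∀ p → IsNode leaf p → p ≡ []
leaf-path [] _ = refl
leaf-path (i ∷ p) (s , ())

embedding-under : ∀ T c Y π w Z g → sub Y w ≡ just Z → ParityEmbedding T c Z (par π w) g →
  ParityEmbedding T c Y π (λ p → w ++ g p)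
embedding-under T c Y π w Z g at (nodes , inj , ncas , parities) =
  (λ p n → let (s , e) = nodes p n in s , ≡-trans (sub-++ Y w (g p) at) e)
  , (λ p q np nq eq → inj p q np nq (++-cancelˡ w _ _ eq))
  , (λ p q np nq → ≡-trans (cong (w ++_) (ncas p q np nq)) (sym (nca-prefix w (g p) (g q))))
  , (λ p ip → ≡-trans (par-++ π w (g p)) (parities p ip))

data BinPath (l r : Tree) : Path → Set where
  root  : BinPath l r []
  left  : ∀ {p} → IsNode l p → BinPath l r (0 ∷ p)
  right : ∀ {p} → IsNode r p → BinPath l r (1 ∷ p)

binPath : ∀ {l r} p → IsNode (node (l ∷ r ∷ [])) p → BinPath l r p
binPath [] _ = root
binPath (zero ∷ p) n = left n
binPath (suc zero ∷ p) n = right n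
binPath (suc (suc _) ∷ p) (_ , ())

join : ℕ → ℕ → (Path → Path) → (Path → Path) → Path → Path
join i j gl gr [] = []
join i j gl gr (zero ∷ p) = i ∷ gl p
join i j gl gr (suc zero ∷ p) = j ∷ gr p
join i j gl gr (suc (suc _) ∷ p) = []

join-embedding : ∀ {l r} (c : Colouring (node (l ∷ r ∷ []))) {i j zs cl cr gl gr} → i ≢ j →
  subL zs i [] ≡ just cl → subL zs j [] ≡ just cr →
  ParityEmbedding l (leftColouring c) cl (not (rootColour c)) gl →
  ParityEmbedding r (rightColouring c) cr (not (rootColour c)) gr →
  ParityEmbedding (node (l ∷ r ∷ [])) c (node zs) (rootColour c) (join i j gl gr)
join-embedding {l} {r} c {i} {j} {zs} {gl = gl} {gr} ne at-i at-j
  (l-nodes , l-inj , l-nca , l-par) (r-nodes , r-inj , r-nca , r-par) =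
  (λ p n → nodes (binPath p n))
  , (λ p q np nq → injective (binPath p np) (binPath q nq))
  , (λ p q np nq → ncas (binPath p np) (binPath q nq))
  , parities
  where
  g : Path → Path
  g = join i j gl gr

  nodes : ∀ {p} → BinPath l r p → IsNode (node zs) (g p)
  nodes root = node zs , refl
  nodes (left {p} n) = let (s , e) = l-nodes p n in s , ≡-trans (subL-++ zs i [] (gl p) at-i) e
  nodes (right {p} n) = let (s , e) = r-nodes p n in s , ≡-trans (subL-++ zs j [] (gr p) at-j) e

  injective : ∀ {p q} → BinPath l r p → BinPath l r q → g p ≡ g q → p ≡ q
  injective root root eq = refl
  injective root (left _) ()
  injective root (right _) ()
  injective (left _) root ()
  injective (right _) root ()
  injective (left np) (left nq) eq = cong (0 ∷_) (l-inj _ _ np nq (∷-injectiveʳ eq))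
  injective (left _) (right _) eq = ⊥-elim (ne (∷-injectiveˡ eq))
  injective (right _) (left _) eq = ⊥-elim (ne (sym (∷-injectiveˡ eq)))
  injective (right np) (right nq) eq = cong (1 ∷_) (r-inj _ _ np nq (∷-injectiveʳ eq))

  ncas : ∀ {p q} → BinPath l r p → BinPath l r q → g (nca p q) ≡ nca (g p) (g q)
  ncas root _ = refl
  ncas (left _) root = refl
  ncas (right _) root = refl
  ncas (left {p} np) (left {q} nq) =
    ≡-trans (cong (i ∷_) (l-nca p q np nq)) (sym (nca-same i (gl p) (gl q)))
  ncas (left {p} _) (right {q} _) = sym (nca-diff i j (gl p) (gr q) ne)
  ncas (right {p} _) (left {q} _) = sym (nca-diff j i (gr p) (gl q) (λ e → ne (sym e)))
  ncas (right {p} np) (right {q} nq) =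
    ≡-trans (cong (j ∷_) (r-nca p q np nq)) (sym (nca-same j (gr p) (gr q)))

  parities : ∀ p (ip : Inner (node (l ∷ r ∷ [])) p) → par (rootColour c) (g p) ≡ c p ip
  parities [] (_ , _ , refl) = refl
  parities (zero ∷ p) ip = l-par p ip
  parities (suc zero ∷ p) ip = r-par p ip
  parities (suc (suc _) ∷ p) (_ , _ , ())

mutual
  extract-root : ∀ T c → Binary T → NoUnary T → ∀ π Z → RootEmb (annotate T c) π Z →
    Σ (Path → Path) (ParityEmbedding T c Z π)
  extract-root (node []) c B N π Z e =
    (λ _ → []) , (λ p n → Z , refl)
    , (λ p q np nq _ → ≡-trans (leaf-path p np) (sym (leaf-path q nq)))
    , (λ p q np nq → refl)
    , (λ { [] (_ , _ , ()) ; (_ ∷ _) (_ , _ , ()) })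
  extract-root (node (x ∷ [])) c B (unary , _) π Z e = ⊥-elim (unary refl)
  extract-root (node (l ∷ r ∷ [])) c (_ , Bl , Br , _) (_ , Nl , Nr , _) .(rootColour c) (node zs) (nodeEmb t)
    with two-positions t
  ... | positions i j ne cl cr at-i at-j el er
    with extract l (leftColouring c) Bl Nl _ cl el | extract r (rightColouring c) Br Nr _ cr er
  ... | gl , Gl | gr , Gr = join i j gl gr , join-embedding c ne at-i at-j Gl Gr
  extract-root (node (x ∷ y ∷ z ∷ zs)) c (s≤s (s≤s ()) , _) N π Z e

  extract : ∀ T c → Binary T → NoUnary T → ∀ π Y → Emb (annotate T c) π Y →
    Σ (Path → Path) (ParityEmbedding T c Y π)
  extract T c B N π Y e with emb-offset e
  ... | w , Z , at , e' with extract-root T c B N (par π w) Z e'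
  ... | g , G = (λ p → w ++ g p) , embedding-under T c Y π w Z g at G

lemma15 : (n : ℕ) → 1 ≤ n → (T : Tree) → Universal (2 * n ∸ 1) T →
    ParityUniversal (BinaryClass n) T
lemma15 n _ T universal T' (binary , noUnary , nLeaves) c =
  let (f , nodes , injective , ncas , parities) = extract T' c binary noUnary false T embedded
  in f , nodes , injective , ncas , λ p ip → ≡-trans (sym (par-false (f p))) (parities p ip)
  where
  X : Pattern
  X = annotate T' c
  small : leaves (realise X false) ≤ 2 * n ∸ 1
  small = ∸-monoˡ-≤ 1 (subst (λ k → suc (leaves (realise X false)) ≤ 2 * k)
    (≡-trans (annotate-size T' c binary noUnary) nLeaves) (realise-leaves X false))
  embedded : Emb X false T
  embedded = implements-⊒ (universal (realise X false) small (realise-noUnary X false)) X false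
    (realise-emb X false)
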